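{- For any nonempty graphs $F$ and $G$ without isolated vertices and any $n$, $\mathrm{ex}_F(n,G)\le \mathrm{ex}(n,G)$.
   Context: All graphs are simple. $\mathrm{ex}(n,G)$ is the maximum number of edges of an $n$-vertex graph with no subgraph isomorphic to $G$. $\mathrm{ex}_F(n,G)$ is the maximum $k$ such that there exist $k$ pairwise edge-disjoint subgraphs $F_1,\dots,F_k$ of $K_n$, each isomorphic to $F$, such that $\bigcup_i F_i$ contains no subgraph $G'$ isomorphic to $G$ with $|E(G')\cap E(F_i)|\le 1$ for every $i$. -}

module Defs where

open import Data.Nat using (ℕ; _<ᵇ_; _≤_)
open import Data.Fin using (Fin; toℕ)
open import Data.Bool using (Bool; true; false; _∧_; if_then_else_)
open import Data.List using (List; map; allFin)
open import Data.Nat.ListAction using (sum)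
open import Data.Product using (Σ; ∃; _×_; _,_)
open import Data.Sum using (_⊎_)
open import Relation.Binary.PropositionalEquality using (_≡_)
open import Relation.Nullary using (¬_)
open import Function.Definitions using (Injective)

record Graph (n : ℕ) : Set where
  field
    Adj    : Fin n → Fin n → Bool
    sym    : ∀ i j → Adj i j ≡ Adj j i
    irrefl : ∀ i → Adj i i ≡ false
open Graph public

Edge : ∀ {n} → Graph n → Fin n → Fin n → Set
Edge H i j = Adj H i j ≡ true

edgeCount : ∀ {n} → Graph n → ℕ
edgeCount {n} H =
  sum (map (λ i → sum (map (λ j → if (toℕ i <ᵇ toℕ j) ∧ Adj H i j then 1 else 0)
                            (allFin n)))
           (allFin n))

Nonempty : ∀ {n} → Graph n → Set
Nonempty H = ∃ λ i → ∃ λ j → Edge H i j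

NoIsolated : ∀ {n} → Graph n → Set
NoIsolated H = ∀ i → ∃ λ j → Edge H i j

Contains : ∀ {n q} → Graph n → Graph q → Set
Contains {n} {q} H G =
  Σ (Fin q → Fin n) λ φ → Injective _≡_ _≡_ φ × (∀ x y → Edge G x y → Edge H (φ x) (φ y))

-- A family of k copies of F in K_n: F_i is the image of F under the injection ψ i.
FCopies : ℕ → ∀ {p} → Graph p → ℕ → Set
FCopies n {p} F k = Σ (Fin k → Fin p → Fin n) λ ψ → ∀ i → Injective _≡_ _≡_ (ψ i)

InCopy : ∀ {n p k} (F : Graph p) → (Fin k → Fin p → Fin n) → Fin k → Fin n → Fin n → Set
InCopy F ψ i u w = ∃ λ a → ∃ λ b → Edge F a b × ψ i a ≡ u × ψ i b ≡ w

EdgeDisjoint : ∀ {n p k} (F : Graph p) → (Fin k → Fin p → Fin n) → Set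
EdgeDisjoint F ψ = ∀ i i' u w → InCopy F ψ i u w → InCopy F ψ i' u w → i ≡ i'

SamePair : ∀ {q} → Fin q → Fin q → Fin q → Fin q → Set
SamePair x y x' y' = (x ≡ x' × y ≡ y') ⊎ (x ≡ y' × y ≡ x')

-- the union of the F_i contains a copy G' of G with |E(G') ∩ E(F_i)| ≤ 1 for all i
HasSpreadCopy : ∀ {n p q k} (F : Graph p) → (Fin k → Fin p → Fin n) → Graph q → Set
HasSpreadCopy {n} {p} {q} {k} F ψ G =
  Σ (Fin q → Fin n) λ φ → Injective _≡_ _≡_ φ
    × (∀ x y → Edge G x y → ∃ λ i → InCopy F ψ i (φ x) (φ y))
    × (∀ i x y x' y' → Edge G x y → Edge G x' y'
         → InCopy F ψ i (φ x) (φ y) → InCopy F ψ i (φ x') (φ y') → SamePair x y x' y')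

-- k is admissible in the definition of ex_F(n,G)
ExFAdmissible : ℕ → ∀ {p q} → Graph p → Graph q → ℕ → Set
ExFAdmissible n F G k =
  Σ (FCopies n F k) λ c → let ψ = Data.Product.proj₁ c in
    EdgeDisjoint F ψ × ¬ HasSpreadCopy F ψ G

-- m is realised in the definition of ex(n,G): some G-free n-vertex graph has ≥ m edges
-- (ex(n,G) ≥ m)
ExAtLeast : (n : ℕ) → ∀ {q} → Graph q → ℕ → Set
ExAtLeast n G m = Σ (Graph n) λ H → ¬ Contains H G × m ≤ edgeCount H

{-# OPTIONS --safe #-}
module Submission where

-- Fix an edge ab of F and let H be the graph whose edges are the images ψᵢ(a)ψᵢ(b) of ab
-- in the k copies Fᵢ. Edge-disjointness makes these k edges distinct, so H has k edges;
-- and every edge of H lies in exactly one Fᵢ, which contributes only that edge, so a copy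
-- of G inside H is a copy meeting each Fᵢ in at most one edge. Thus H is G-free.

open import Defs
open import Data.Bool using (Bool; true; false; _∧_; if_then_else_)
open import Data.Bool.Properties using (T-≡; T-∧)
open import Data.Empty using (⊥-elim)
open import Data.Fin using (Fin; toℕ; _≟_; _<_)
open import Data.Fin.Properties using (any?; <-cmp; injective⇒≤)
open import Data.List using (List; []; _∷_; _++_; map; length; allFin; filterᵇ; cartesianProduct)
open import Data.List.Properties using (map-++; map-∘)
open import Data.List.Membership.Propositional using (_∈_)
open import Data.List.Membership.Propositional.Properties
  using (∈-filter⁺; ∈-cartesianProduct⁺; ∈-allFin)
open import Data.List.Membership.Setoid.Properties using (index-injective)
open import Data.Nat using (ℕ; _+_; _≤_; _<ᵇ_)
open import Data.Nat.ListAction using (sum)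
open import Data.Nat.ListAction.Properties using (sum-++)
open import Data.Nat.Properties using (<⇒<ᵇ)
open import Data.Product using (∃; ∃₂; _×_; _,_; proj₁; proj₂; uncurry)
open import Data.Product.Properties using (,-injective)
open import Data.Sum using (inj₁; inj₂)
open import Function using (_∘_)
open import Function.Bundles using (Equivalence; mk⇔)
open import Function.Definitions using (Injective)
open import Relation.Binary.Definitions using (tri<; tri≈; tri>)
open import Relation.Binary.PropositionalEquality as ≡
  using (_≡_; _≢_; refl; cong; cong₂; setoid; module ≡-Reasoning)
open import Relation.Nullary using (¬_; Dec; yes; no; does)
open import Relation.Nullary.Decidable using (T?; dec-true; dec-false; does-⇔; _×-dec_; _⊎-dec_)

dec-true⁻ : ∀ {a} {A : Set a} (a? : Dec A) → does a? ≡ true → A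
dec-true⁻ (yes a) _ = a
dec-true⁻ (no _) ()

sum-indicator≡length-filterᵇ : ∀ {a} {A : Set a} (b : A → Bool) (xs : List A) →
  sum (map (λ x → if b x then 1 else 0) xs) ≡ length (filterᵇ b xs)
sum-indicator≡length-filterᵇ b [] = refl
sum-indicator≡length-filterᵇ b (x ∷ xs) with b x
... | true  = cong (1 +_) (sum-indicator≡length-filterᵇ b xs)
... | false = sum-indicator≡length-filterᵇ b xs

sum-map-sum≡sum-cartesianProduct : ∀ {a b} {A : Set a} {B : Set b}
  (c : A → B → ℕ) (xs : List A) (ys : List B) →
  sum (map (λ x → sum (map (c x) ys)) xs) ≡ sum (map (uncurry c) (cartesianProduct xs ys))
sum-map-sum≡sum-cartesianProduct c [] ys = refl
sum-map-sum≡sum-cartesianProduct c (x ∷ xs) ys = begin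
  sum (map (c x) ys) + sum (map (λ x → sum (map (c x) ys)) xs)
    ≡⟨ cong₂ _+_ (cong sum (map-∘ ys)) (sum-map-sum≡sum-cartesianProduct c xs ys) ⟩
  sum (map (uncurry c) (map (x ,_) ys)) + sum (map (uncurry c) (cartesianProduct xs ys))
    ≡⟨ ≡.sym (sum-++ (map (uncurry c) (map (x ,_) ys)) _) ⟩
  sum (map (uncurry c) (map (x ,_) ys) ++ map (uncurry c) (cartesianProduct xs ys))
    ≡⟨ cong sum (≡.sym (map-++ (uncurry c) (map (x ,_) ys) (cartesianProduct xs ys))) ⟩
  sum (map (uncurry c) (cartesianProduct (x ∷ xs) ys)) ∎
  where open ≡-Reasoning

injective-into⇒≤length : ∀ {a k} {A : Set a} {xs : List A} (f : Fin k → A) →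
  Injective _≡_ _≡_ f → (∀ t → f t ∈ xs) → k ≤ length xs
injective-into⇒≤length {A = A} f f-inj f∈xs =
  injective⇒≤ (f-inj ∘ index-injective (setoid A) (f∈xs _) (f∈xs _))

module _ {q : ℕ} where

  SamePair-sym : {x y x' y' : Fin q} → SamePair x y x' y' → SamePair x' y' x y
  SamePair-sym (inj₁ (refl , refl)) = inj₁ (refl , refl)
  SamePair-sym (inj₂ (refl , refl)) = inj₂ (refl , refl)

  SamePair-trans : {x y x' y' x'' y'' : Fin q} →
    SamePair x y x' y' → SamePair x' y' x'' y'' → SamePair x y x'' y''
  SamePair-trans (inj₁ (refl , refl)) s                    = s
  SamePair-trans (inj₂ (refl , refl)) (inj₁ (refl , refl)) = inj₂ (refl , refl)
  SamePair-trans (inj₂ (refl , refl)) (inj₂ (refl , refl)) = inj₁ (refl , refl)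

  SamePair-swapˡ : {x y x' y' : Fin q} → SamePair x y x' y' → SamePair y x x' y'
  SamePair-swapˡ (inj₁ (refl , refl)) = inj₂ (refl , refl)
  SamePair-swapˡ (inj₂ (refl , refl)) = inj₁ (refl , refl)

  SamePair-injective : ∀ {n} {φ : Fin q → Fin n} → Injective _≡_ _≡_ φ →
    {x y x' y' : Fin q} → SamePair (φ x) (φ y) (φ x') (φ y') → SamePair x y x' y'
  SamePair-injective φ-inj (inj₁ (p₁ , p₂)) = inj₁ (φ-inj p₁ , φ-inj p₂)
  SamePair-injective φ-inj (inj₂ (p₁ , p₂)) = inj₂ (φ-inj p₁ , φ-inj p₂)

  SamePair-sorted : (u w : Fin q) → u ≢ w → ∃₂ λ lo hi → lo < hi × SamePair lo hi u w
  SamePair-sorted u w u≢w with <-cmp u w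
  ... | tri< u<w _ _ = u , w , u<w , inj₁ (refl , refl)
  ... | tri≈ _ u≡w _ = ⊥-elim (u≢w u≡w)
  ... | tri> _ _ w<u = w , u , w<u , inj₂ (refl , refl)

isOrderedEdge : ∀ {n} → Graph n → Fin n × Fin n → Bool
isOrderedEdge H (i , j) = (toℕ i <ᵇ toℕ j) ∧ Adj H i j

edgeCount≡length-filter : ∀ {n} (H : Graph n) →
  edgeCount H ≡ length (filterᵇ (isOrderedEdge H) (cartesianProduct (allFin n) (allFin n)))
edgeCount≡length-filter {n} H = ≡.trans
  (sum-map-sum≡sum-cartesianProduct (λ i j → if isOrderedEdge H (i , j) then 1 else 0)
    (allFin n) (allFin n))
  (sum-indicator≡length-filterᵇ (isOrderedEdge H) (cartesianProduct (allFin n) (allFin n)))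

injective-ordered-edges⇒≤edgeCount : ∀ {n k} (H : Graph n) (f : Fin k → Fin n × Fin n) →
  Injective _≡_ _≡_ f → (∀ t → proj₁ (f t) < proj₂ (f t)) →
  (∀ t → Edge H (proj₁ (f t)) (proj₂ (f t))) → k ≤ edgeCount H
injective-ordered-edges⇒≤edgeCount H f f-inj ordered edge =
  ≡.subst (_ ≤_) (≡.sym (edgeCount≡length-filter H))
    (injective-into⇒≤length f f-inj λ t →
      ∈-filter⁺ (T? ∘ isOrderedEdge H) (∈-cartesianProduct⁺ (∈-allFin _) (∈-allFin _))
        (Equivalence.from T-∧ (<⇒<ᵇ (ordered t) , Equivalence.from T-≡ (edge t))))

module Spanned {n k : ℕ} (A B : Fin k → Fin n) (A≢B : ∀ t → A t ≢ B t) where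

  Joins : Fin n → Fin n → Fin k → Set
  Joins u w t = SamePair u w (A t) (B t)

  Joins? : ∀ u w t → Dec (Joins u w t)
  Joins? u w t = ((u ≟ A t) ×-dec (w ≟ B t)) ⊎-dec ((u ≟ B t) ×-dec (w ≟ A t))

  ¬Joins-loop : ∀ u t → ¬ Joins u u t
  ¬Joins-loop u t (inj₁ (p , q)) = A≢B t (≡.trans (≡.sym p) q)
  ¬Joins-loop u t (inj₂ (p , q)) = A≢B t (≡.trans (≡.sym q) p)

  spanned : Graph n
  spanned = record
    { Adj    = λ u w → does (any? (Joins? u w))
    ; sym    = λ u w → does-⇔ (mk⇔ swap swap) (any? (Joins? u w)) (any? (Joins? w u))
    ; irrefl = λ u → dec-false (any? (Joins? u u)) λ (t , j) → ¬Joins-loop u t j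
    }
    where
    swap : ∀ {u w} → ∃ (Joins u w) → ∃ (Joins w u)
    swap (t , j) = t , SamePair-swapˡ j

  Edge-spanned⁺ : ∀ {u w} t → Joins u w t → Edge spanned u w
  Edge-spanned⁺ {u} {w} t j = dec-true (any? (Joins? u w)) (t , j)

  Edge-spanned⁻ : ∀ {u w} → Edge spanned u w → ∃ (Joins u w)
  Edge-spanned⁻ {u} {w} = dec-true⁻ (any? (Joins? u w))

  ≤edgeCount-spanned : (∀ t t' → Joins (A t) (B t) t' → t ≡ t') → k ≤ edgeCount spanned
  ≤edgeCount-spanned distinct =
    injective-ordered-edges⇒≤edgeCount spanned (λ t → lo t , hi t) pair-inj lo<hi
      (λ t → Edge-spanned⁺ t (lohi-joins t))
    where
    sorted : ∀ t → ∃₂ λ lo hi → lo < hi × Joins lo hi t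
    sorted t = SamePair-sorted (A t) (B t) (A≢B t)

    lo hi : Fin k → Fin n
    lo t = proj₁ (sorted t)
    hi t = proj₁ (proj₂ (sorted t))

    lo<hi : ∀ t → lo t < hi t
    lo<hi t = proj₁ (proj₂ (proj₂ (sorted t)))

    lohi-joins : ∀ t → Joins (lo t) (hi t) t
    lohi-joins t = proj₂ (proj₂ (proj₂ (sorted t)))

    pair-inj : Injective _≡_ _≡_ (λ t → lo t , hi t)
    pair-inj {t} {t'} eq with lo≡ , hi≡ ← ,-injective eq = distinct t t'
      (SamePair-trans (SamePair-sym (≡.subst₂ (λ u w → Joins u w t) lo≡ hi≡ (lohi-joins t)))
                      (lohi-joins t'))

module OneEdgePerCopy {n p k : ℕ} (F : Graph p) (ψ : Fin k → Fin p → Fin n)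
  (ψ-inj : ∀ i → Injective _≡_ _≡_ (ψ i)) (disjoint : EdgeDisjoint F ψ)
  {a b : Fin p} (ab : Edge F a b) where

  a≢b : a ≢ b
  a≢b refl with () ← ≡.trans (≡.sym ab) (irrefl F a)

  open Spanned (λ i → ψ i a) (λ i → ψ i b) (λ i → a≢b ∘ ψ-inj i) public

  Joins⇒InCopy : ∀ {u w i} → Joins u w i → InCopy F ψ i u w
  Joins⇒InCopy (inj₁ (refl , refl)) = a , b , ab , refl , refl
  Joins⇒InCopy (inj₂ (refl , refl)) = b , a , ≡.trans (Graph.sym F b a) ab , refl , refl

  InCopy-Joins-unique : ∀ {u w i i'} → InCopy F ψ i u w → Joins u w i' → i ≡ i'
  InCopy-Joins-unique c j = disjoint _ _ _ _ c (Joins⇒InCopy j)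

  pairs-distinct : ∀ i i' → Joins (ψ i a) (ψ i b) i' → i ≡ i'
  pairs-distinct i i' = InCopy-Joins-unique (Joins⇒InCopy {i = i} (inj₁ (refl , refl)))

  Contains-spanned⇒HasSpreadCopy : ∀ {q} {G : Graph q} → Contains spanned G → HasSpreadCopy F ψ G
  Contains-spanned⇒HasSpreadCopy {G = G} (φ , φ-inj , φ-edge) = φ , φ-inj , covered , spread
    where
    joins : ∀ {x y} → Edge G x y → ∃ (Joins (φ x) (φ y))
    joins {x} {y} e = Edge-spanned⁻ (φ-edge x y e)

    covered : ∀ x y → Edge G x y → ∃ λ i → InCopy F ψ i (φ x) (φ y)
    covered x y e = let i , j = joins e in i , Joins⇒InCopy j

    joins-copy : ∀ {i x y} → Edge G x y → InCopy F ψ i (φ x) (φ y) → Joins (φ x) (φ y) i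
    joins-copy e c = let i , j = joins e in ≡.subst (Joins _ _) (≡.sym (InCopy-Joins-unique c j)) j

    spread : ∀ i x y x' y' → Edge G x y → Edge G x' y'
           → InCopy F ψ i (φ x) (φ y) → InCopy F ψ i (φ x') (φ y') → SamePair x y x' y'
    spread i x y x' y' e e' c c' = SamePair-injective φ-inj
      (SamePair-trans (joins-copy e c) (SamePair-sym (joins-copy e' c')))

corollary1 : ∀ {p q} (F : Graph p) (G : Graph q)
           → Nonempty F → NoIsolated F → Nonempty G → NoIsolated G
           → ∀ (n k : ℕ) → ExFAdmissible n F G k → ExAtLeast n G k
corollary1 F G (a , b , ab) _ _ _ n k ((ψ , ψ-inj) , disjoint , no-spread-copy) =
  spanned
  , no-spread-copy ∘ Contains-spanned⇒HasSpreadCopy {G = G}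
  , ≤edgeCount-spanned pairs-distinct
  where open OneEdgePerCopy F ψ ψ-inj disjoint ab
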